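{- Let $D$ be a finite digraph and let $D_1,D_2,\dots,D_t$ be the strong components of $D$ (the maximal strongly connected subdigraphs). Let $k\ge 2$. Then $D$ is $k$-AW if and only if each $D_i$ is $k$-AW.
   Context: A digraph is strongly connected if for every ordered pair of vertices $v,w$ there is a directed walk from $v$ to $w$. The $k$-lights out game on a digraph $D$: start with a labeling $\lambda:V(D)\to\mathbb{Z}_k$. Toggling a vertex $v$ increases by $1$ (mod $k$) the label of $v$ and of every vertex $w$ with $vw\in A(D)$. The game is won when every vertex has label $0$. A labeling is $k$-winnable if some sequence of toggles wins the game from it. $D$ is $k$-Always Winnable ($k$-AW) if every labeling $V(D)\to\mathbb{Z}_k$ is $k$-winnable. -}

module Defs where

open import Data.Nat using (ℕ; zero; suc)
open import Data.Nat.DivMod using (_%_; m%n<n)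
open import Data.Fin using (Fin; toℕ) renaming (zero to fzero)
open import Data.Fin using (fromℕ<; _≟_)
open import Data.Bool using (Bool; true; false; if_then_else_; _∨_)
open import Data.List using (List; []; _∷_; foldl)
open import Data.List.Relation.Unary.All using (All)
open import Data.Product using (Σ; _×_)
open import Relation.Nullary.Decidable using (⌊_⌋)
open import Relation.Binary.PropositionalEquality using (_≡_)

record Digraph (n : ℕ) : Set where
  field
    arc      : Fin n → Fin n → Bool
    loopless : ∀ v → arc v v ≡ false
open Digraph public

data Walk {n : ℕ} (D : Digraph n) : Fin n → Fin n → Set where
  here : ∀ {v} → Walk D v v
  step : ∀ {u v w} → arc D u v ≡ true → Walk D v w → Walk D u w

StrongComp : ∀ {n} → Digraph n → Fin n → Fin n → Set
StrongComp D v w = Walk D v w × Walk D w v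

incr : ∀ {k} → Fin k → Fin k
incr {suc m} i = fromℕ< (m%n<n (suc (toℕ i)) (suc m))

Labeling : ℕ → ℕ → Set
Labeling n k = Fin n → Fin k

toggle : ∀ {n k} → Digraph n → Labeling n k → Fin n → Labeling n k
toggle D λ₀ v w = if (⌊ w ≟ v ⌋ ∨ arc D v w) then incr (λ₀ w) else λ₀ w

play : ∀ {n k} → Digraph n → Labeling n k → List (Fin n) → Labeling n k
play D = foldl (toggle D)

AW : ∀ {n} → (k : ℕ) → Digraph n → Set
AW {n} k D = ∀ (λ₀ : Labeling n k) →
  Σ (List (Fin n)) λ ts → ∀ w → toℕ (play D λ₀ ts w) ≡ 0

-- The induced subdigraph D[S] (S a set of vertices) is k-Always Winnable:
-- every labeling of S can be won by toggling only vertices of S, where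
-- toggles act via the arcs of D restricted to S.  (A labeling of S is the
-- restriction of a labeling of D; values outside S are never inspected.)
AWInduced : ∀ {n} → (k : ℕ) → Digraph n → (Fin n → Set) → Set
AWInduced {n} k D S = ∀ (λ₀ : Labeling n k) →
  Σ (List (Fin n)) λ ts → All S ts × (∀ w → S w → toℕ (play D λ₀ ts w) ≡ 0)

-- Pressing u adds 1 to the label of w exactly when w = u or uw is an arc, so only the
-- number of presses of each vertex mod k matters: λ is winnable iff -λ lies in the image
-- of the linear map x ↦ A x over ℤ_k.  For a vertex set S, D[S] is k-AW iff the block A_S
-- is surjective, equivalently injective, ℤ_k^S being finite.  If D is k-AW, A is surjective
-- on the set of ancestors of v, since no arc enters it, hence injective there; no arc leads
-- from the component of v to another ancestor of v, so injectivity passes to its block.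
-- Conversely, if every component block is injective and A x = A y, then x and y agree on a
-- component once they agree on its strict ancestors, as their contributions then cancel;
-- strict ancestry is well founded.
module Submission where

open import Defs
open import Data.Nat using (ℕ; zero; suc; _+_; _*_; _∸_; _^_; _≤_; pred; NonZero; >-nonZero⁻¹)
open import Data.Nat.Properties
  using (1+n≰n; +-identityʳ; +-comm; +-assoc; *-identityˡ; *-zeroʳ; *-suc; *-distribʳ-+;
         m+[n∸m]≡n; suc-pred; <⇒≤; +-*-semiring)
open import Data.Nat.DivMod
  using (_%_; _mod_; m%n%n≡m%n; %-distribˡ-+; %-distribˡ-*; [m+kn]%n≡m%n; n%n≡0; m<n⇒m%n≡m)
open import Data.Fin using (Fin; zero; suc; toℕ; punchOut; combine; funToFin; finToFun; _≟_)
open import Data.Fin.Properties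
  using (any?; punchOut-injective; injective⇒≤; funToFin-finToFin; finToFun-funToFin;
         toℕ-fromℕ<; toℕ<n; toℕ-injective)
open import Data.Fin.Induction using (spo-wellFounded)
open import Data.Fin.Subset using (Subset; _∈_; _∉_; _⊆_; _⊃_; _∪_; ⁅_⁆)
open import Data.Fin.Subset.Properties
  using (_∈?_; p⊆p∪q; x∈p∪q⁻; x∈p∪q⁺; x∈⁅x⁆; x∈⁅y⁆⇒x≡y)
open import Data.Fin.Subset.Induction using (⊃-wellFounded; Acc; acc)
open import Algebra.Properties.Semiring.Sum +-*-semiring
  using (sum-cong-≗; ∑-distrib-+; sum-replicate-zero; sum-syntax)
open import Data.Bool using (Bool; true; false; if_then_else_; _∨_)
open import Data.List using (List; []; _∷_; _++_; concat; tabulate; replicate; filter)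
open import Data.List.Relation.Unary.All using (All; []; _∷_)
open import Data.List.Relation.Unary.All.Properties using (concat⁺; tabulate⁺; replicate⁺; all-filter)
open import Relation.Nullary.Decidable using (⌊_⌋; dec-true; dec-false; toSum)
import Relation.Unary as U
open import Relation.Unary.Properties using (∁?; U?)
import Data.Bool.Properties as Bool
open import Data.Product using (Σ-syntax; ∃₂; _×_; _,_; proj₁; proj₂)
open import Data.Sum using (_⊎_; inj₁; inj₂; [_,_]′)
open import Function using (_∘_; _$_; id)
open import Function.Definitions using (Injective; StrictlySurjective; Congruent)
open import Induction.WellFounded using (WellFounded; module All)
open import Relation.Binary using (Rel)
open import Relation.Nullary using (¬_; Dec; yes; no; does; contradiction; ¬?; _×-dec_)
open import Relation.Binary.PropositionalEquality

Fin-injective⇒surjective : ∀ {m} (f : Fin m → Fin m) →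
  Injective _≡_ _≡_ f → StrictlySurjective _≡_ f
Fin-injective⇒surjective f f-inj y with any? (λ x → f x ≟ y)
... | yes f⁻¹y = f⁻¹y
Fin-injective⇒surjective {suc m} f f-inj y | no y∉im =
  contradiction (injective⇒≤ punchOut∘f-injective) 1+n≰n
  where
  y≢f : ∀ x → y ≢ f x
  y≢f x y≡fx = y∉im (x , sym y≡fx)
  punchOut∘f-injective : Injective _≡_ _≡_ (λ x → punchOut (y≢f x))
  punchOut∘f-injective eq = f-inj (punchOut-injective (y≢f _) (y≢f _) eq)

Fin-surjective⇒injective : ∀ {m} (f : Fin m → Fin m) →
  StrictlySurjective _≡_ f → Injective _≡_ _≡_ f
Fin-surjective⇒injective f f-surj {x} {y} fx≡fy = begin
  x        ≡⟨ g∘f x ⟨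
  g (f x)  ≡⟨ cong g fx≡fy ⟩
  g (f y)  ≡⟨ g∘f y ⟩
  y        ∎
  where
  open ≡-Reasoning
  g = proj₁ ∘ f-surj
  f∘g : ∀ z → f (g z) ≡ z
  f∘g = proj₂ ∘ f-surj
  g-injective : Injective _≡_ _≡_ g
  g-injective {a} {b} ga≡gb = trans (sym (f∘g a)) (trans (cong f ga≡gb) (f∘g b))
  g∘f : ∀ z → g (f z) ≡ z
  g∘f z =
    let a , ga≡z = Fin-injective⇒surjective g g-injective z
    in  trans (cong (g ∘ f) (sym ga≡z)) (trans (cong g (f∘g a)) ga≡z)

funToFin-cong : ∀ {n k} {f g : Fin n → Fin k} → f ≗ g → funToFin f ≡ funToFin g
funToFin-cong {zero} f≗g = refl
funToFin-cong {suc n} f≗g = cong₂ combine (f≗g zero) (funToFin-cong (f≗g ∘ suc))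

funToFin-injective : ∀ {n k} {f g : Fin n → Fin k} → funToFin f ≡ funToFin g → f ≗ g
funToFin-injective {f = f} {g} eq i =
  trans (sym (finToFun-funToFin f i)) (trans (cong (λ j → finToFun j i) eq) (finToFun-funToFin g i))

module _ {n k} (F : (Fin n → Fin k) → (Fin n → Fin k)) (F-cong : Congruent _≗_ _≗_ F) where

  private
    F̂ : Fin (k ^ n) → Fin (k ^ n)
    F̂ = funToFin ∘ F ∘ finToFun

    F̂-funToFin : ∀ x → F̂ (funToFin x) ≡ funToFin (F x)
    F̂-funToFin x = funToFin-cong (F-cong (finToFun-funToFin x))

    finToFun-injective : ∀ {i j} → finToFun {k} {n} i ≗ finToFun j → i ≡ j
    finToFun-injective {i} {j} eq =
      trans (sym (funToFin-finToFin {n} {k} i)) (trans (funToFin-cong eq) (funToFin-finToFin {n} j))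

  injective⇒surjective : Injective _≗_ _≗_ F → StrictlySurjective _≗_ F
  injective⇒surjective F-inj y =
    let i , F̂i≡y = Fin-injective⇒surjective F̂ F̂-inj (funToFin y)
    in  finToFun i , funToFin-injective F̂i≡y
    where
    F̂-inj : Injective _≡_ _≡_ F̂
    F̂-inj = finToFun-injective ∘ F-inj ∘ funToFin-injective

  surjective⇒injective : StrictlySurjective _≗_ F → Injective _≗_ _≗_ F
  surjective⇒injective F-surj {x} {y} Fx≗Fy = funToFin-injective (F̂-inj (begin
    F̂ (funToFin x)  ≡⟨ F̂-funToFin x ⟩
    funToFin (F x)  ≡⟨ funToFin-cong Fx≗Fy ⟩
    funToFin (F y)  ≡⟨ F̂-funToFin y ⟨
    F̂ (funToFin y)  ∎))
    where
    open ≡-Reasoning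
    F̂-surj : StrictlySurjective _≡_ F̂
    F̂-surj j =
      let x , Fx≗j = F-surj (finToFun j)
      in  funToFin x , trans (F̂-funToFin x) (trans (funToFin-cong Fx≗j) (funToFin-finToFin {n} j))
    F̂-inj : Injective _≡_ _≡_ F̂
    F̂-inj = Fin-surjective⇒injective F̂ F̂-surj

module Reachability {n} (D : Digraph n) where

  _++ʷ_ : ∀ {a b c} → Walk D a b → Walk D b c → Walk D a c
  here ++ʷ q = q
  step a→x p ++ʷ q = step a→x (p ++ʷ q)

  OutClosed : Subset n → Set
  OutClosed R = ∀ {r t} → r ∈ R → arc D r t ≡ true → t ∈ R

  outClosed-walk : ∀ {R a b} → OutClosed R → a ∈ R → Walk D a b → b ∈ R
  outClosed-walk closed a∈R here = a∈R
  outClosed-walk closed a∈R (step a→x p) = outClosed-walk closed (closed a∈R a→x) p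

  Exit : Subset n → Set
  Exit R = ∃₂ λ r t → r ∈ R × arc D r t ≡ true × t ∉ R

  exit? : ∀ R → Dec (Exit R)
  exit? R = any? λ r → any? λ t → r ∈? R ×-dec (arc D r t Bool.≟ true) ×-dec ¬? (t ∈? R)

  ¬exit⇒outClosed : ∀ {R} → ¬ Exit R → OutClosed R
  ¬exit⇒outClosed {R} ¬exit {r} {t} r∈R r→t with t ∈? R
  ... | yes t∈R = t∈R
  ... | no t∉R = contradiction (r , t , r∈R , r→t , t∉R) ¬exit

  saturate : ∀ {u} R → Acc _⊃_ R → (∀ {t} → t ∈ R → Walk D u t) →
    Σ[ R′ ∈ Subset n ] R ⊆ R′ × OutClosed R′ × (∀ {t} → t ∈ R′ → Walk D u t)
  saturate R _ reachable with exit? R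
  ... | no ¬exit = R , id , ¬exit⇒outClosed ¬exit , reachable
  saturate {u} R (acc rec) reachable | yes (r , t , r∈R , r→t , t∉R) =
    let R′ , R+t⊆R′ , closed , reachable′ = saturate (R ∪ ⁅ t ⁆) (rec R⊂R+t) reachable+t
    in  R′ , R+t⊆R′ ∘ p⊆p∪q ⁅ t ⁆ , closed , reachable′
    where
    R⊂R+t = (λ {x} → p⊆p∪q ⁅ t ⁆) , t , x∈p∪q⁺ (inj₂ (x∈⁅x⁆ t)) , t∉R
    reachable+t : ∀ {x} → x ∈ R ∪ ⁅ t ⁆ → Walk D u x
    reachable+t {x} x∈R+t with x∈p∪q⁻ R ⁅ t ⁆ x∈R+t
    ... | inj₁ x∈R = reachable x∈R
    ... | inj₂ x∈⁅t⁆ rewrite x∈⁅y⁆⇒x≡y t x∈⁅t⁆ = reachable r∈R ++ʷ step r→t here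

  walk? : ∀ u v → Dec (Walk D u v)
  walk? u v with saturate ⁅ u ⁆ (⊃-wellFounded _) from-u
    where
    from-u : ∀ {t} → t ∈ ⁅ u ⁆ → Walk D u t
    from-u t∈⁅u⁆ rewrite x∈⁅y⁆⇒x≡y u t∈⁅u⁆ = here
  ... | R , ⁅u⁆⊆R , closed , reachable with v ∈? R
  ...   | yes v∈R = yes (reachable v∈R)
  ...   | no v∉R = no (v∉R ∘ outClosed-walk closed (⁅u⁆⊆R (x∈⁅x⁆ u)))

  StrongComp? : ∀ v → U.Decidable (StrongComp D v)
  StrongComp? v t = walk? v t ×-dec walk? t v

  StrictAncestor : Rel (Fin n) _
  StrictAncestor t v = Walk D t v × ¬ Walk D v t

  strictAncestor-wellFounded : WellFounded StrictAncestor
  strictAncestor-wellFounded = spo-wellFounded {_≈_ = _≡_} record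
    { isEquivalence = isEquivalence
    ; irrefl        = λ { refl (_ , ¬v→v) → ¬v→v here }
    ; trans         = λ (a→b , _) (b→c , ¬c→b) → a→b ++ʷ b→c , λ c→a → ¬c→b (c→a ++ʷ a→b)
    ; <-resp-≈      = resp₂ StrictAncestor
    }

module ModularArithmetic (k : ℕ) .{{_ : NonZero k}} where

  infix 4 _≡ₖ_

  _≡ₖ_ : ℕ → ℕ → Set
  a ≡ₖ b = a % k ≡ b % k

  %-≡ₖ : ∀ a → a % k ≡ₖ a
  %-≡ₖ a = m%n%n≡m%n a k

  toℕ-% : (i : Fin k) → toℕ i % k ≡ toℕ i
  toℕ-% i = m<n⇒m%n≡m (toℕ<n i)

  toℕ-mod : ∀ a → toℕ (a mod k) ≡ a % k
  toℕ-mod a = toℕ-fromℕ< _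

  mod-cong : ∀ {a b} → a ≡ₖ b → a mod k ≡ b mod k
  mod-cong {a} {b} eq = toℕ-injective (trans (toℕ-mod a) (trans eq (sym (toℕ-mod b))))

  +-congₖ : ∀ {a a′ b b′} → a ≡ₖ a′ → b ≡ₖ b′ → a + b ≡ₖ a′ + b′
  +-congₖ {a} {a′} {b} {b′} eq₁ eq₂ = begin
    (a + b) % k            ≡⟨ %-distribˡ-+ a b k ⟩
    (a % k + b % k) % k    ≡⟨ cong₂ (λ x y → (x + y) % k) eq₁ eq₂ ⟩
    (a′ % k + b′ % k) % k  ≡⟨ %-distribˡ-+ a′ b′ k ⟨
    (a′ + b′) % k          ∎
    where open ≡-Reasoning

  %-absorbˡ : ∀ a b → (a % k + b) % k ≡ (a + b) % k
  %-absorbˡ a b = +-congₖ {a % k} {a} {b} {b} (%-≡ₖ a) refl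

  %-absorbʳ : ∀ a b → (a + b % k) % k ≡ (a + b) % k
  %-absorbʳ a b = +-congₖ {a} {a} {b % k} {b} refl (%-≡ₖ b)

  *-congʳₖ : ∀ c {a a′} → a ≡ₖ a′ → a * c ≡ₖ a′ * c
  *-congʳₖ c {a} {a′} eq = begin
    (a * c) % k            ≡⟨ %-distribˡ-* a c k ⟩
    (a % k * (c % k)) % k  ≡⟨ cong (λ x → (x * (c % k)) % k) eq ⟩
    (a′ % k * (c % k)) % k ≡⟨ %-distribˡ-* a′ c k ⟨
    (a′ * c) % k           ∎
    where open ≡-Reasoning

  ∑-congₖ : ∀ {p} {f g : Fin p → ℕ} → (∀ i → f i ≡ₖ g i) →
            ∑[ i < p ] f i ≡ₖ ∑[ i < p ] g i
  ∑-congₖ {zero}  eq = refl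
  ∑-congₖ {suc p} eq = +-congₖ (eq zero) (∑-congₖ (eq ∘ suc))

  +-cancelʳₖ : ∀ {a b} c → a + c ≡ₖ b + c → a ≡ₖ b
  +-cancelʳₖ {a} {b} c eq = begin
    a % k                     ≡⟨ [m+kn]%n≡m%n a c k ⟨
    (a + c * k) % k           ≡⟨ cong (_% k) (+c*k≡ a) ⟩
    (a + c + c * pred k) % k  ≡⟨ +-congₖ eq refl ⟩
    (b + c + c * pred k) % k  ≡⟨ cong (_% k) (+c*k≡ b) ⟨
    (b + c * k) % k           ≡⟨ [m+kn]%n≡m%n b c k ⟩
    b % k                     ∎
    where
    open ≡-Reasoning
    +c*k≡ : ∀ x → x + c * k ≡ x + c + c * pred k
    +c*k≡ x = begin
      x + c * k                ≡⟨ cong (λ y → x + c * y) (suc-pred k) ⟨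
      x + c * suc (pred k)     ≡⟨ cong (x +_) (*-suc c (pred k)) ⟩
      x + (c + c * pred k)     ≡⟨ +-assoc x c _ ⟨
      x + c + c * pred k       ∎

  negate : Fin k → Fin k
  negate i = (k ∸ toℕ i) mod k

  0%k≡0 : 0 % k ≡ 0
  0%k≡0 = m<n⇒m%n≡m (>-nonZero⁻¹ k)

  +-negateₖ : ∀ i → toℕ i + toℕ (negate i) ≡ₖ 0
  +-negateₖ i = begin
    (toℕ i + toℕ (negate i)) % k ≡⟨ cong (λ x → (toℕ i + x) % k) (toℕ-mod (k ∸ toℕ i)) ⟩
    (toℕ i + (k ∸ toℕ i) % k) % k ≡⟨ %-absorbʳ (toℕ i) (k ∸ toℕ i) ⟩
    (toℕ i + (k ∸ toℕ i)) % k    ≡⟨ cong (_% k) (m+[n∸m]≡n (<⇒≤ (toℕ<n i))) ⟩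
    k % k                        ≡⟨ n%n≡0 k ⟩
    0                            ≡⟨ 0%k≡0 ⟨
    0 % k                        ∎
    where open ≡-Reasoning

  %≡negate⇒+%≡0 : ∀ {i b} → b % k ≡ toℕ (negate i) → (toℕ i + b) % k ≡ 0
  %≡negate⇒+%≡0 {i} {b} eq = begin
    (toℕ i + b) % k               ≡⟨ %-absorbʳ (toℕ i) b ⟨
    (toℕ i + b % k) % k           ≡⟨ cong (λ x → (toℕ i + x) % k) eq ⟩
    (toℕ i + toℕ (negate i)) % k  ≡⟨ +-negateₖ i ⟩
    0 % k                         ≡⟨ 0%k≡0 ⟩
    0                             ∎
    where open ≡-Reasoning

  negate+%≡0⇒%≡ : ∀ {i b} → (toℕ (negate i) + b) % k ≡ 0 → b % k ≡ toℕ i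
  negate+%≡0⇒%≡ {i} {b} eq = trans (+-cancelʳₖ (toℕ (negate i)) (begin
    (b + toℕ (negate i)) % k  ≡⟨ cong (_% k) (+-comm b _) ⟩
    (toℕ (negate i) + b) % k  ≡⟨ trans eq (sym 0%k≡0) ⟩
    0 % k                     ≡⟨ +-negateₖ i ⟨
    (toℕ i + toℕ (negate i)) % k ∎)) (toℕ-% i)
    where open ≡-Reasoning

-- does rather than ⌊_⌋, so that indicator (suc t) (suc u) reduces to indicator t u.
indicator : ∀ {p} → Fin p → Fin p → ℕ
indicator t u = if does (u ≟ t) then 1 else 0

∑-indicator : ∀ {p} (t : Fin p) (f : Fin p → ℕ) → ∑[ u < p ] (indicator t u * f u) ≡ f t
∑-indicator {suc p} zero f = begin
  1 * f zero + ∑[ u < p ] 0  ≡⟨ cong₂ _+_ (*-identityˡ (f zero)) (sum-replicate-zero p) ⟩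
  f zero + 0                 ≡⟨ +-identityʳ (f zero) ⟩
  f zero                     ∎
  where open ≡-Reasoning
∑-indicator {suc p} (suc t) f = ∑-indicator t (f ∘ suc)

module LightsOut {n} (D : Digraph n) (m : ℕ) where

  open Reachability D

  k : ℕ
  k = suc m

  open ModularArithmetic k

  affects : Fin n → Fin n → Bool
  affects u w = ⌊ w ≟ u ⌋ ∨ arc D u w

  affects⇒≡⊎arc : ∀ {u w} → affects u w ≡ true → w ≡ u ⊎ arc D u w ≡ true
  affects⇒≡⊎arc {u} {w} affects-uw with w ≟ u
  ... | yes w≡u = inj₁ w≡u
  ... | no _ = inj₂ affects-uw

  affects⇒walk : ∀ {u w} → affects u w ≡ true → Walk D u w
  affects⇒walk affects-uw with affects⇒≡⊎arc affects-uw
  ... | inj₁ refl = here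
  ... | inj₂ u→w = step u→w here

  hit : Fin n → Fin n → ℕ
  hit u w = if affects u w then 1 else 0

  hits : List (Fin n) → Fin n → ℕ
  hits [] w = 0
  hits (t ∷ ts) w = hit t w + hits ts w

  toℕ-toggle : ∀ (λ₀ : Labeling n k) t w → toℕ (toggle D λ₀ t w) ≡ (toℕ (λ₀ w) + hit t w) % k
  toℕ-toggle λ₀ t w with affects t w
  ... | true = trans (toℕ-fromℕ< _) (cong (_% k) (+-comm 1 (toℕ (λ₀ w))))
  ... | false = trans (sym (toℕ-% (λ₀ w))) (cong (_% k) (sym (+-identityʳ (toℕ (λ₀ w)))))

  toℕ-play : ∀ ts (λ₀ : Labeling n k) w → toℕ (play D λ₀ ts w) ≡ (toℕ (λ₀ w) + hits ts w) % k
  toℕ-play [] λ₀ w = trans (sym (toℕ-% (λ₀ w))) (cong (_% k) (sym (+-identityʳ (toℕ (λ₀ w)))))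
  toℕ-play (t ∷ ts) λ₀ w = begin
    toℕ (play D (toggle D λ₀ t) ts w)
      ≡⟨ toℕ-play ts (toggle D λ₀ t) w ⟩
    (toℕ (toggle D λ₀ t w) + hits ts w) % k
      ≡⟨ cong (λ a → (a + hits ts w) % k) (toℕ-toggle λ₀ t w) ⟩
    ((toℕ (λ₀ w) + hit t w) % k + hits ts w) % k
      ≡⟨ %-absorbˡ (toℕ (λ₀ w) + hit t w) (hits ts w) ⟩
    (toℕ (λ₀ w) + hit t w + hits ts w) % k
      ≡⟨ cong (_% k) (+-assoc (toℕ (λ₀ w)) _ _) ⟩
    (toℕ (λ₀ w) + hits (t ∷ ts) w) % k
      ∎
    where open ≡-Reasoning

  hits-++ : ∀ ts us w → hits (ts ++ us) w ≡ hits ts w + hits us w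
  hits-++ [] us w = refl
  hits-++ (t ∷ ts) us w = trans (cong (hit t w +_) (hits-++ ts us w)) (sym (+-assoc (hit t w) _ _))

  hits-replicate : ∀ c u w → hits (replicate c u) w ≡ c * hit u w
  hits-replicate zero u w = refl
  hits-replicate (suc c) u w = cong (hit u w +_) (hits-replicate c u w)

  hits-concat-tabulate : ∀ {p} (g : Fin p → List (Fin n)) w →
    hits (concat (tabulate g)) w ≡ ∑[ i < p ] hits (g i) w
  hits-concat-tabulate {zero} g w = refl
  hits-concat-tabulate {suc p} g w =
    trans (hits-++ (g zero) _ w) (cong (hits (g zero) w +_) (hits-concat-tabulate (g ∘ suc) w))

  multiplicity : List (Fin n) → Fin n → ℕ
  multiplicity [] u = 0
  multiplicity (t ∷ ts) u = indicator t u + multiplicity ts u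

  hits≡∑multiplicity : ∀ ts w → hits ts w ≡ ∑[ u < n ] (multiplicity ts u * hit u w)
  hits≡∑multiplicity [] w = sym (sum-replicate-zero n)
  hits≡∑multiplicity (t ∷ ts) w = begin
    hit t w + hits ts w
      ≡⟨ cong₂ _+_ (∑-indicator t (λ u → hit u w)) (sym (hits≡∑multiplicity ts w)) ⟨
    ∑[ u < n ] (indicator t u * hit u w) + ∑[ u < n ] (multiplicity ts u * hit u w)
      ≡⟨ ∑-distrib-+ (λ u → indicator t u * hit u w) _ ⟨
    ∑[ u < n ] (indicator t u * hit u w + multiplicity ts u * hit u w)
      ≡⟨ sum-cong-≗ (λ u → *-distribʳ-+ (hit u w) (indicator t u) _) ⟨
    ∑[ u < n ] (multiplicity (t ∷ ts) u * hit u w) ∎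
    where open ≡-Reasoning

  multiplicity-∉ : ∀ {S : Fin n → Set} {ts u} → All S ts → ¬ S u → multiplicity ts u ≡ 0
  multiplicity-∉ [] ¬su = refl
  multiplicity-∉ {ts = t ∷ _} {u} (st ∷ sts) ¬su with u ≟ t
  ... | yes refl = contradiction st ¬su
  ... | no _ = multiplicity-∉ sts ¬su

  Toggles : Set
  Toggles = Fin n → Fin k

  effect : Toggles → Fin n → ℕ
  effect x w = ∑[ u < n ] (toℕ (x u) * hit u w)

  effect-local : ∀ {x y w} → (∀ u → affects u w ≡ true → x u ≡ y u) → effect x w ≡ effect y w
  effect-local {x} {y} {w} x≡y = sum-cong-≗ term
    where
    term : ∀ u → toℕ (x u) * hit u w ≡ toℕ (y u) * hit u w
    term u with affects u w in affects-uw
    ... | true = cong (λ z → toℕ z * 1) (x≡y u affects-uw)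
    ... | false = trans (*-zeroʳ (toℕ (x u))) (sym (*-zeroʳ (toℕ (y u))))

  effect-congₖ : ∀ {x} (c : Fin n → ℕ) w → (∀ u → toℕ (x u) ≡ₖ c u) →
    effect x w ≡ₖ ∑[ u < n ] (c u * hit u w)
  effect-congₖ {x} c w x≡ₖc = ∑-congₖ {f = λ u → toℕ (x u) * hit u w} {g = λ u → c u * hit u w}
    λ u → *-congʳₖ (hit u w) {toℕ (x u)} {c u} (x≡ₖc u)

  pressAll : Toggles → List (Fin n)
  pressAll x = concat (tabulate λ u → replicate (toℕ (x u)) u)

  hits-pressAll : ∀ x w → hits (pressAll x) w ≡ effect x w
  hits-pressAll x w = trans (hits-concat-tabulate (λ u → replicate (toℕ (x u)) u) w)
                            (sum-cong-≗ λ u → hits-replicate (toℕ (x u)) u w)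

  module _ {S : Fin n → Set} (S? : U.Decidable S) where

    restrict : Toggles → Toggles
    restrict x u = if does (S? u) then x u else zero

    -- The block of the lights-out system on S, extended by the identity off S: it is
    -- bijective iff that block is, and it is an endomap of the finite set Toggles.
    block : Toggles → Toggles
    block x w = if does (S? w) then effect (restrict x) w mod k else x w

    restrict-∈ : ∀ {x u} → S u → restrict x u ≡ x u
    restrict-∈ {u = u} su rewrite dec-true (S? u) su = refl

    restrict-∉ : ∀ {x u} → ¬ S u → restrict x u ≡ zero
    restrict-∉ {u = u} ¬su rewrite dec-false (S? u) ¬su = refl

    toℕ-block-∈ : ∀ {x w} → S w → toℕ (block x w) ≡ effect (restrict x) w % k
    toℕ-block-∈ {x} {w} sw rewrite dec-true (S? w) sw = toℕ-mod (effect (restrict x) w)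

    block-∉ : ∀ {x w} → ¬ S w → block x w ≡ x w
    block-∉ {w = w} ¬sw rewrite dec-false (S? w) ¬sw = refl

    block-cong : Congruent _≗_ _≗_ block
    block-cong {x} {y} x≗y w with does (S? w)
    ... | true = cong (_mod k) (effect-local λ u _ → cong (if does (S? u) then_else zero) (x≗y u))
    ... | false = x≗y w

    InjectiveOn : Set
    InjectiveOn = ∀ {x y} → (∀ {w} → S w → effect (restrict x) w ≡ₖ effect (restrict y) w) →
                  ∀ {u} → S u → x u ≡ y u

    injective⇒injectiveOn : Injective _≗_ _≗_ block → InjectiveOn
    injective⇒injectiveOn inj {x} {y} x≡ₖy {u} su =
      trans (sym (restrict-∈ {x} su))
            (trans (inj {restrict x} {restrict y} restricted-blocks u) (restrict-∈ {y} su))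
      where
      restrict-idem : ∀ z → restrict (restrict z) ≗ restrict z
      restrict-idem z v with does (S? v)
      ... | true = refl
      ... | false = refl
      restricted-blocks : block (restrict x) ≗ block (restrict y)
      restricted-blocks w with S? w
      ... | yes sw = mod-cong {effect (restrict (restrict x)) w} {effect (restrict (restrict y)) w} (begin
        effect (restrict (restrict x)) w % k ≡⟨ cong (_% k) (effect-local λ v _ → restrict-idem x v) ⟩
        effect (restrict x) w % k            ≡⟨ x≡ₖy sw ⟩
        effect (restrict y) w % k            ≡⟨ cong (_% k) (effect-local λ v _ → restrict-idem y v) ⟨
        effect (restrict (restrict y)) w % k ∎)
        where open ≡-Reasoning
      ... | no _ = refl

    injectiveOn⇒injective : InjectiveOn → Injective _≗_ _≗_ block
    injectiveOn⇒injective inj {x} {y} bx≗by u with S? u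
    ... | yes su = inj {x} {y} (λ sw → trans (sym (toℕ-block-∈ sw))
                                             (trans (cong toℕ (bx≗by _)) (toℕ-block-∈ sw))) su
    ... | no ¬su = trans (sym (block-∉ ¬su)) (trans (bx≗by u) (block-∉ ¬su))

    pressAll-restrict : ∀ x → All S (pressAll (restrict x))
    pressAll-restrict x = concat⁺ (tabulate⁺ pressed)
      where
      pressed : ∀ u → All S (replicate (toℕ (restrict x u)) u)
      pressed u with S? u
      ... | yes su = replicate⁺ (toℕ (x u)) su
      ... | no _ = []

    surjective⇒winnable : StrictlySurjective _≗_ block → AWInduced k D S
    surjective⇒winnable surj λ₀ with surj (negate ∘ λ₀)
    ... | x , block-x≗-λ₀ = pressAll (restrict x) , pressAll-restrict x , solved
      where
      solved : ∀ w → S w → toℕ (play D λ₀ (pressAll (restrict x)) w) ≡ 0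
      solved w sw = begin
        toℕ (play D λ₀ (pressAll (restrict x)) w)
          ≡⟨ toℕ-play (pressAll (restrict x)) λ₀ w ⟩
        (toℕ (λ₀ w) + hits (pressAll (restrict x)) w) % k
          ≡⟨ cong (λ h → (toℕ (λ₀ w) + h) % k) (hits-pressAll (restrict x) w) ⟩
        (toℕ (λ₀ w) + effect (restrict x) w) % k
          ≡⟨ %≡negate⇒+%≡0 {λ₀ w} {effect (restrict x) w} effect≡-λ₀ ⟩
        0 ∎
        where
        open ≡-Reasoning
        effect≡-λ₀ : effect (restrict x) w % k ≡ toℕ (negate (λ₀ w))
        effect≡-λ₀ = trans (sym (toℕ-block-∈ sw)) (cong toℕ (block-x≗-λ₀ w))

    winnable⇒surjective : AWInduced k D S → StrictlySurjective _≗_ block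
    winnable⇒surjective win y with win (negate ∘ y)
    ... | ts , ts⊆S , solved = x , block-x≗y
      where
      x : Toggles
      x u = if does (S? u) then multiplicity ts u mod k else y u
      restrict-x : ∀ u → toℕ (restrict x u) ≡ₖ multiplicity ts u
      restrict-x u with S? u
      ... | yes _ = trans (cong (_% k) (toℕ-mod (multiplicity ts u))) (%-≡ₖ (multiplicity ts u))
      ... | no ¬su = cong (_% k) (sym (multiplicity-∉ ts⊆S ¬su))
      block-x≗y : block x ≗ y
      block-x≗y w = [ in-S , out-S ]′ (toSum (S? w))
        where
        in-S : S w → block x w ≡ y w
        in-S sw = toℕ-injective (begin
          toℕ (block x w)                               ≡⟨ toℕ-block-∈ sw ⟩
          effect (restrict x) w % k                     ≡⟨ effect-congₖ {restrict x} (multiplicity ts) w restrict-x ⟩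
          ∑[ u < n ] (multiplicity ts u * hit u w) % k  ≡⟨ cong (_% k) (hits≡∑multiplicity ts w) ⟨
          hits ts w % k                                 ≡⟨ negate+%≡0⇒%≡ {y w} {hits ts w} y-solved ⟩
          toℕ (y w)                                     ∎)
          where
          open ≡-Reasoning
          y-solved : (toℕ (negate (y w)) + hits ts w) % k ≡ 0
          y-solved = trans (sym (toℕ-play ts (negate ∘ y) w)) (solved w sw)
        out-S : ¬ S w → block x w ≡ y w
        out-S ¬sw rewrite dec-false (S? w) ¬sw = refl

  winnable⇒injectiveOn : ∀ {S} (S? : U.Decidable S) → AWInduced k D S → InjectiveOn S?
  winnable⇒injectiveOn S? =
    injective⇒injectiveOn S? ∘ surjective⇒injective (block S?) (block-cong S?) ∘ winnable⇒surjective S?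

  injectiveOn⇒winnable : ∀ {S} (S? : U.Decidable S) → InjectiveOn S? → AWInduced k D S
  injectiveOn⇒winnable S? =
    surjective⇒winnable S? ∘ injective⇒surjective (block S?) (block-cong S?) ∘ injectiveOn⇒injective S?

  InClosed : (Fin n → Set) → Set
  InClosed S = ∀ {t w} → arc D t w ≡ true → S w → S t

  hits-filter : ∀ {S} (S? : U.Decidable S) → InClosed S →
                ∀ ts {w} → S w → hits (filter S? ts) w ≡ hits ts w
  hits-filter S? closed [] sw = refl
  hits-filter {S} S? closed (t ∷ ts) {w} sw with S? t
  ... | yes _ = cong (hit t w +_) (hits-filter S? closed ts sw)
  ... | no ¬st with affects t w in affects-tw
  ...   | false = hits-filter S? closed ts sw
  ...   | true = contradiction ([ (λ w≡t → subst S w≡t sw) , (λ t→w → closed t→w sw) ]′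
                                     (affects⇒≡⊎arc affects-tw)) ¬st

  AW⇒AWInduced : ∀ {S} (S? : U.Decidable S) → InClosed S → AW k D → AWInduced k D S
  AW⇒AWInduced S? closed aw λ₀ with aw λ₀
  ... | ts , solved = filter S? ts , all-filter S? ts , solved-filtered
    where
    solved-filtered : ∀ w → _ → toℕ (play D λ₀ (filter S? ts) w) ≡ 0
    solved-filtered w sw = begin
      toℕ (play D λ₀ (filter S? ts) w)
        ≡⟨ toℕ-play (filter S? ts) λ₀ w ⟩
      (toℕ (λ₀ w) + hits (filter S? ts) w) % k
        ≡⟨ cong (λ h → (toℕ (λ₀ w) + h) % k) (hits-filter S? closed ts sw) ⟩
      (toℕ (λ₀ w) + hits ts w) % k
        ≡⟨ toℕ-play ts λ₀ w ⟨
      toℕ (play D λ₀ ts w)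
        ≡⟨ solved w ⟩
      0 ∎
      where open ≡-Reasoning

  injectiveOn-⊆ : ∀ {T S} (T? : U.Decidable T) (S? : U.Decidable S) → (∀ {u} → T u → S u) →
    (∀ {t w} → T t → S w → arc D t w ≡ true → T w) → InjectiveOn S? → InjectiveOn T?
  injectiveOn-⊆ {T} {S} T? S? T⊆S T-sink injS {x} {y} x≡ₖy {u} tu = begin
    x u              ≡⟨ restrict-∈ T? {x} tu ⟨
    restrict T? x u  ≡⟨ injS {restrict T? x} {restrict T? y} restricted≡ₖ (T⊆S tu) ⟩
    restrict T? y u  ≡⟨ restrict-∈ T? {y} tu ⟩
    y u              ∎
    where
    open ≡-Reasoning
    restrict-⊆ : ∀ z v → restrict S? (restrict T? z) v ≡ restrict T? z v
    restrict-⊆ z v with T? v | S? v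
    ... | yes _  | yes _   = refl
    ... | yes tv | no ¬sv  = contradiction (T⊆S tv) ¬sv
    ... | no _   | yes _   = refl
    ... | no _   | no _    = refl
    outside-T : ∀ {w} → S w → ¬ T w → effect (restrict T? x) w ≡ effect (restrict T? y) w
    outside-T {w} sw ¬tw = effect-local λ v affects-vw →
      trans (restrict-∉ T? {x} (¬T v affects-vw)) (sym (restrict-∉ T? {y} (¬T v affects-vw)))
      where
      ¬T : ∀ v → affects v w ≡ true → ¬ T v
      ¬T v affects-vw tv =
        ¬tw ([ (λ w≡v → subst T (sym w≡v) tv) , T-sink tv sw ]′ (affects⇒≡⊎arc affects-vw))
    restricted≡ₖ : ∀ {w} → S w →
      effect (restrict S? (restrict T? x)) w ≡ₖ effect (restrict S? (restrict T? y)) w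
    restricted≡ₖ {w} sw = begin
      effect (restrict S? (restrict T? x)) w % k  ≡⟨ cong (_% k) (effect-local λ v _ → restrict-⊆ x v) ⟩
      effect (restrict T? x) w % k                ≡⟨ [ x≡ₖy , cong (_% k) ∘ outside-T sw ]′ (toSum (T? w)) ⟩
      effect (restrict T? y) w % k                ≡⟨ cong (_% k) (effect-local λ v _ → restrict-⊆ y v) ⟨
      effect (restrict S? (restrict T? y)) w % k  ∎

  effect-split : ∀ {S} (S? : U.Decidable S) x w →
    effect x w ≡ effect (restrict S? x) w + effect (restrict (∁? S?) x) w
  effect-split S? x w = trans (sum-cong-≗ split)
    (∑-distrib-+ (λ u → toℕ (restrict S? x u) * hit u w) (λ u → toℕ (restrict (∁? S?) x u) * hit u w))
    where
    split : ∀ u → toℕ (x u) * hit u w ≡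
                  toℕ (restrict S? x u) * hit u w + toℕ (restrict (∁? S?) x u) * hit u w
    split u with does (S? u)
    ... | true  = sym (+-identityʳ _)
    ... | false = refl

  injectiveOn-cancelOutside : ∀ {C} (C? : U.Decidable C) → InjectiveOn C? → ∀ {x y} →
    (∀ {w} → C w → effect x w ≡ₖ effect y w) →
    (∀ {t w} → C w → ¬ C t → affects t w ≡ true → x t ≡ y t) →
    ∀ {u} → C u → x u ≡ y u
  injectiveOn-cancelOutside {C} C? injC {x} {y} x≡ₖy x≡y-outside = injC {x} {y} inside≡ₖ
    where
    inside≡ₖ : ∀ {w} → C w → effect (restrict C? x) w ≡ₖ effect (restrict C? y) w
    inside≡ₖ {w} cw =
      +-cancelʳₖ {effect (restrict C? x) w} {effect (restrict C? y) w} (effect (restrict (∁? C?) x) w) (begin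
        (effect (restrict C? x) w + effect (restrict (∁? C?) x) w) % k  ≡⟨ cong (_% k) (effect-split C? x w) ⟨
        effect x w % k                                                ≡⟨ x≡ₖy cw ⟩
        effect y w % k                                                ≡⟨ cong (_% k) (effect-split C? y w) ⟩
        (effect (restrict C? y) w + effect (restrict (∁? C?) y) w) % k  ≡⟨ cong (λ e → (effect (restrict C? y) w + e) % k) outside ⟨
        (effect (restrict C? y) w + effect (restrict (∁? C?) x) w) % k  ∎)
      where
      open ≡-Reasoning
      outside : effect (restrict (∁? C?) x) w ≡ effect (restrict (∁? C?) y) w
      outside = effect-local λ t affects-tw →
        [ (λ ct → trans (restrict-∉ (∁? C?) {x} (_$ ct)) (sym (restrict-∉ (∁? C?) {y} (_$ ct))))
        , (λ ¬ct → trans (restrict-∈ (∁? C?) {x} ¬ct)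
                     (trans (x≡y-outside cw ¬ct affects-tw) (sym (restrict-∈ (∁? C?) {y} ¬ct))))
        ]′ (toSum (C? t))

  componentsInjective⇒injective : (∀ v → InjectiveOn (StrongComp? v)) → InjectiveOn U?
  componentsInjective⇒injective injC {x} {y} x≡ₖy {u} _ =
    All.wfRec strictAncestor-wellFounded _ (λ v → x v ≡ y v) agree u
    where
    agree : ∀ v → (∀ {t} → StrictAncestor t v → x t ≡ y t) → x v ≡ y v
    agree v ih = injectiveOn-cancelOutside (StrongComp? v) (injC v) (λ _ → x≡ₖy _) upstream (here , here)
      where
      upstream : ∀ {t w} → StrongComp D v w → ¬ StrongComp D v t → affects t w ≡ true → x t ≡ y t
      upstream (_ , w→v) ¬ct affects-tw = ih (t→v , λ v→t → ¬ct (v→t , t→v))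
        where t→v = affects⇒walk affects-tw ++ʷ w→v

  AW⇒componentsWinnable : AW k D → ∀ v → AWInduced k D (StrongComp D v)
  AW⇒componentsWinnable aw v =
    injectiveOn⇒winnable (StrongComp? v)
      (injectiveOn-⊆ (StrongComp? v) Ancestor? proj₂ stays-in-component
        (winnable⇒injectiveOn Ancestor? (AW⇒AWInduced Ancestor? (λ t→w w→v → step t→w w→v) aw)))
    where
    Ancestor? : U.Decidable (λ t → Walk D t v)
    Ancestor? t = walk? t v
    stays-in-component : ∀ {t w} → StrongComp D v t → Walk D w v → arc D t w ≡ true → StrongComp D v w
    stays-in-component (v→t , _) w→v t→w = v→t ++ʷ step t→w here , w→v

  componentsWinnable⇒AW : (∀ v → AWInduced k D (StrongComp D v)) → AW k D
  componentsWinnable⇒AW win λ₀ =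
    let ts , _ , solved = injectiveOn⇒winnable U? (componentsInjective⇒injective injC) λ₀
    in  ts , λ w → solved w _
    where
    injC : ∀ v → InjectiveOn (StrongComp? v)
    injC v = winnable⇒injectiveOn (StrongComp? v) (win v)

mainTheorem3 : (n k : ℕ) → 2 ≤ k → (D : Digraph n) →
    (AW k D → ∀ (v : Fin n) → AWInduced k D (StrongComp D v)) ×
    ((∀ (v : Fin n) → AWInduced k D (StrongComp D v)) → AW k D)
mainTheorem3 n zero () D
mainTheorem3 n (suc m) _ D = AW⇒componentsWinnable , componentsWinnable⇒AW
  where open LightsOut D m
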